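{- (1) Let $\phi$ be a sentence of $\mathtt{ME}(A)$ in basic form $\bigvee_j\nabla(\vec T_j,\Pi_j)$ (with $\Pi_j\subseteq\vec T_j$) and let $\phi^\circ:=\bigvee_j\big(\bigwedge_i\exists x_i.\tau_{T_{j,i}}(x_i)\wedge\forall x.\bigvee_{S\in\Pi_j}\tau_S(x)\big)$. Then for every monadic model $(D,V)$: $(D,V)\models\phi^\circ$ iff $(D\times\omega,V_\pi)\models\phi$. (2) Let $\phi$ be a sentence of $\mathtt{ME}^\infty(A)$ in basic form $\bigvee_j\nabla(\vec T_j,\Pi_j,\Sigma_j)$ with $\Sigma_j\subseteq\Pi_j\subseteq\vec T_j$ for each $j$, and let $\phi^\bullet:=\bigvee_j\big(\bigwedge_i\exists x_i.\tau_{T_{j,i}}(x_i)\wedge\forall x.\bigvee_{S\in\Sigma_j}\tau_S(x)\big)$. Then for every monadic model $(D,V)$: $(D,V)\models\phi^\bullet$ iff $(D\times\omega,V_\pi)\models\phi$.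
   Context: Fix a finite set $A$ of monadic predicate symbols. A monadic model is $(D,V)$, $D$ a set (possibly empty), $V:A\to\wp(D)$. $\mathtt{ME}^\infty(A)$ is monadic first-order logic with equality in negation normal form extended with $\exists^\infty$ ("infinitely many") and $\forall^\infty$ ("all but finitely many"); $\mathtt{ME}(A)$ is its fragment without these. On the empty model, $\exists,\exists^\infty$-sentences are false and $\forall,\forall^\infty$-sentences true. For $(D,V)$, $V_\pi$ is the valuation on $D\times\omega$ given by $V_\pi(a):=\{(d,k): d\in V(a),k\in\omega\}$. For $S\subseteq A$: $\tau_S(x):=\bigwedge_{a\in S}a(x)\wedge\bigwedge_{a\in A\setminus S}\neg a(x)$; $\mathrm{diff}(y_1,\dots,y_n):=\bigwedge_{m<m'}y_m\not\approx y_{m'}$; $\mathrm{diff}(\vec y)\to\psi$ abbreviates $\bigvee_{m<m'}y_m\approx y_{m'}\vee\psi$; empty conjunction $\top$, empty disjunction $\bot$. For $\vec T=(T_1,\dots,T_k)\in\wp(A)^k$, $\Lambda\subseteq\wp(A)$: $\nabla(\vec T,\Lambda):=\exists x_1\cdots x_k.(\mathrm{diff}(\vec x)\wedge\bigwedge_i\tau_{T_i}(x_i)\wedge\forall z.(\mathrm{diff}(\vec x,z)\to\bigvee_{S\in\Lambda}\tau_S(z)))$; $\nabla(\vec T,\Pi,\Sigma):=\nabla(\vec T,\Pi\cup\Sigma)\wedge\bigwedge_{S\in\Sigma}\exists^\infty y.\tau_S(y)\wedge\forall^\infty y.\bigvee_{S\in\Sigma}\tau_S(y)$. $T_{j,i}$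 denotes the $i$-th entry of $\vec T_j$; inclusions in $\vec T$ refer to the set of its entries. -}

module Defs where

open import Data.Nat using (ℕ; zero; suc)
open import Data.Fin using (Fin; zero; suc)
open import Data.Bool using (Bool; true; false; if_then_else_)
open import Data.Vec using (Vec; lookup)
open import Data.List using (List; []; _∷_; map; _++_; _∷ʳ_; allFin; length)
open import Data.List.Membership.Propositional using (_∈_)
open import Data.List.Relation.Binary.Subset.Propositional using (_⊆_)
open import Data.Product using (Σ; _×_; _,_)
open import Data.Sum using (_⊎_)
open import Data.Unit using (⊤)
open import Data.Empty using (⊥)
open import Relation.Nullary using (¬_)
open import Relation.Binary.PropositionalEquality using (_≡_)

-- The finite set A of monadic predicate symbols is  Fin nA.
-- A subset S ⊆ A is a characteristic vector  Vec Bool nA.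

PSet : ℕ → Set
PSet nA = Vec Bool nA

-- Syntax of ME^∞(A) in negation normal form, with de Bruijn variables:
-- Fm nA m = formulas with at most m free variables (Fin m).

data Fm (nA : ℕ) : ℕ → Set where
  atom  : ∀ {m} → Fin nA → Fin m → Fm nA m
  natom : ∀ {m} → Fin nA → Fin m → Fm nA m
  eq    : ∀ {m} → Fin m → Fin m → Fm nA m
  neq   : ∀ {m} → Fin m → Fin m → Fm nA m
  tt    : ∀ {m} → Fm nA m
  ff    : ∀ {m} → Fm nA m
  _∧'_  : ∀ {m} → Fm nA m → Fm nA m → Fm nA m
  _∨'_  : ∀ {m} → Fm nA m → Fm nA m → Fm nA m
  ∃'    : ∀ {m} → Fm nA (suc m) → Fm nA m            -- ∃ x. φ   (x = variable zero)
  ∀'    : ∀ {m} → Fm nA (suc m) → Fm nA m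
  ∃∞'   : ∀ {m} → Fm nA (suc m) → Fm nA m
  ∀∞'   : ∀ {m} → Fm nA (suc m) → Fm nA m

Sentence : ℕ → Set
Sentence nA = Fm nA 0

-- Monadic models (D , V), V : A → ℘(D); D may be empty.

record Model (nA : ℕ) : Set₁ where
  constructor ⟨_,_⟩
  field
    D : Set
    V : Fin nA → D → Set
open Model public

πModel : ∀ {nA} → Model nA → Model nA
πModel M = ⟨ D M × ℕ , (λ a p → V M a (Data.Product.proj₁ p)) ⟩

FiniteP : {X : Set} → (X → Set) → Set
FiniteP {X} P = Σ (List X) λ l → ∀ x → P x → x ∈ l

_∷ₑ_ : ∀ {X : Set} {m} → X → (Fin m → X) → Fin (suc m) → X
(x ∷ₑ ρ) zero = x
(x ∷ₑ ρ) (suc i) = ρ i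

sat : ∀ {nA m} (M : Model nA) → (Fin m → D M) → Fm nA m → Set
sat M ρ (atom a x)  = V M a (ρ x)
sat M ρ (natom a x) = ¬ V M a (ρ x)
sat M ρ (eq x y)    = ρ x ≡ ρ y
sat M ρ (neq x y)   = ¬ (ρ x ≡ ρ y)
sat M ρ tt          = ⊤
sat M ρ ff          = ⊥
sat M ρ (φ ∧' ψ)    = sat M ρ φ × sat M ρ ψ
sat M ρ (φ ∨' ψ)    = sat M ρ φ ⊎ sat M ρ ψ
sat M ρ (∃' φ)      = Σ (D M) λ d → sat M (d ∷ₑ ρ) φ
sat M ρ (∀' φ)      = ∀ d → sat M (d ∷ₑ ρ) φ
sat M ρ (∃∞' φ)     = ¬ FiniteP (λ d → sat M (d ∷ₑ ρ) φ)
sat M ρ (∀∞' φ)     = FiniteP (λ d → ¬ sat M (d ∷ₑ ρ) φ)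

noVars : {X : Set} → Fin 0 → X
noVars ()

_⊨_ : ∀ {nA} → Model nA → Sentence nA → Set
M ⊨ φ = sat M noVars φ

⋀ : ∀ {nA m} → List (Fm nA m) → Fm nA m
⋀ []       = tt
⋀ (φ ∷ φs) = φ ∧' ⋀ φs

⋁ : ∀ {nA m} → List (Fm nA m) → Fm nA m
⋁ []       = ff
⋁ (φ ∷ φs) = φ ∨' ⋁ φs

τ : ∀ {nA m} → PSet nA → Fin m → Fm nA m
τ {nA} S x = ⋀ (map (λ a → if lookup S a then atom a x else natom a x) (allFin nA))

pairs : {X : Set} → List X → List (X × X)
pairs []       = []
pairs (y ∷ ys) = map (λ z → (y , z)) ys ++ pairs ys

diff : ∀ {nA m} → List (Fin m) → Fm nA m
diff ys = ⋀ (map (λ p → neq (Data.Product.proj₁ p) (Data.Product.proj₂ p)) (pairs ys))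

diff⇒ : ∀ {nA m} → List (Fin m) → Fm nA m → Fm nA m
diff⇒ ys ψ = ⋁ (map (λ p → eq (Data.Product.proj₁ p) (Data.Product.proj₂ p)) (pairs ys)) ∨' ψ

-- ∃ x_1 ⋯ x_k . φ   (x_i is the variable i : Fin k)
exs : ∀ {nA} k → Fm nA k → Fm nA 0
exs zero    φ = φ
exs (suc k) φ = exs k (∃' φ)

∇ : ∀ {nA} → List (PSet nA) → List (PSet nA) → Sentence nA
∇ {nA} T Λ =
  exs k ( diff xs
       ∧' ( ⋀ (map (λ i → τ (Data.List.lookup T i) i) xs)
       ∧' ∀' (diff⇒ (map suc xs ∷ʳ zero) (⋁ (map (λ S → τ S zero) Λ))) ) )
  where
    k = length T
    xs = allFin k

∇∞ : ∀ {nA} → List (PSet nA) → List (PSet nA) → List (PSet nA) → Sentence nA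
∇∞ T Π Σ' =
  ∇ T (Π ++ Σ') ∧' ( ⋀ (map (λ S → ∃∞' (τ S zero)) Σ')
                  ∧' ∀∞' (⋁ (map (λ S → τ S zero) Σ')) )

record Basic (nA : ℕ) : Set where
  constructor basic
  field
    T  : List (PSet nA)
    Π  : List (PSet nA)
open Basic public

record Basic∞ (nA : ℕ) : Set where
  constructor basic∞
  field
    T∞ : List (PSet nA)
    Π∞ : List (PSet nA)
    Σ∞ : List (PSet nA)
open Basic∞ public

basicSentence : ∀ {nA} → List (Basic nA) → Sentence nA
basicSentence bs = ⋁ (map (λ b → ∇ (T b) (Π b)) bs)

basicSentence∞ : ∀ {nA} → List (Basic∞ nA) → Sentence nA
basicSentence∞ bs = ⋁ (map (λ b → ∇∞ (T∞ b) (Π∞ b) (Σ∞ b)) bs)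

circPart : ∀ {nA} → List (PSet nA) → List (PSet nA) → Sentence nA
circPart T Λ = ⋀ (map (λ Ti → ∃' (τ Ti zero)) T) ∧' ∀' (⋁ (map (λ S → τ S zero) Λ))

circ : ∀ {nA} → List (Basic nA) → Sentence nA
circ bs = ⋁ (map (λ b → circPart (T b) (Π b)) bs)

bullet : ∀ {nA} → List (Basic∞ nA) → Sentence nA
bullet bs = ⋁ (map (λ b → circPart (T∞ b) (Σ∞ b)) bs)

WellFormed : ∀ {nA} → Basic nA → Set
WellFormed b = Π b ⊆ T b

WellFormed∞ : ∀ {nA} → Basic∞ nA → Set
WellFormed∞ b = (Σ∞ b ⊆ Π∞ b) × (Π∞ b ⊆ T∞ b)

-- In D × ω every realized type is realized by infinitely many elements,
-- so distinct witnesses for T⃗_j can always be chosen, and each d ∈ D has copies (d , n)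
-- avoiding any given finite set: the universal clause of ∇ and the clause ∀^∞ of ∇(T⃗, Π, Σ)
-- therefore constrain the type of every d.  The infinity quantifiers hold automatically for
-- realized types, which is where Σ_j ⊆ T⃗_j enters.
module Submission where

open import Defs
open import Level using (0ℓ)
open import Axiom.ExcludedMiddle using (ExcludedMiddle)
open import Data.Nat using (ℕ)
import Data.Nat as ℕ
open import Data.Nat.Properties using (n≮n)
open import Data.Fin using (Fin; zero; suc; toℕ)
open import Data.Fin.Properties using (toℕ-injective)
open import Data.Bool using (true; false; if_then_else_)
open import Data.Vec using (lookup)
open import Data.List using (List; []; _∷_; map; _++_; _∷ʳ_; allFin; length)
import Data.List as List
open import Data.List.Extrema.Nat using (max; xs≤max)
open import Data.List.Membership.Propositional using (_∈_; _∉_)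
open import Data.List.Membership.Propositional.Properties using (∈-map⁺; ∈-lookup; ∈-allFin)
open import Data.List.Relation.Binary.Subset.Propositional using (_⊆_)
open import Data.List.Relation.Unary.All as All using (All; []; _∷_)
import Data.List.Relation.Unary.All.Properties as All
open import Data.List.Relation.Unary.Any as Any using (Any; here; there)
import Data.List.Relation.Unary.Any.Properties as Any
open import Data.List.Relation.Unary.AllPairs using (AllPairs; []; _∷_)
import Data.List.Relation.Unary.AllPairs as AllPairs
import Data.List.Relation.Unary.AllPairs.Properties as AllPairs
open import Data.List.Relation.Unary.Unique.Propositional.Properties using (allFin⁺)
open import Data.Product using (∃; ∃-syntax; _×_; _,_; proj₁; proj₂; uncurry)
import Data.Sum as Sum
open import Data.Sum using (inj₁; inj₂)
open import Data.Unit using (tt)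
open import Data.Empty using (⊥-elim)
open import Function using (_∘_; id; _on_)
open import Function.Bundles using (_⇔_; mk⇔; Equivalence)
open import Function.Construct.Composition using (_⇔-∘_)
open import Relation.Nullary using (¬_; yes; no)
open import Relation.Binary.PropositionalEquality
  using (_≡_; _≢_; refl; sym; trans; cong; cong₂; subst)

open Equivalence using (to; from)

∷ₑ-cong : ∀ {X : Set} {m} (x : X) {ρ σ : Fin m → X} →
          (∀ i → ρ i ≡ σ i) → ∀ i → (x ∷ₑ ρ) i ≡ (x ∷ₑ σ) i
∷ₑ-cong x ρ≗σ zero    = refl
∷ₑ-cong x ρ≗σ (suc i) = ρ≗σ i

sat-cong : ∀ {nA m} (M : Model nA) {ρ σ : Fin m → D M} (φ : Fm nA m) →
           (∀ i → ρ i ≡ σ i) → sat M ρ φ → sat M σ φ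
sat-cong M (atom a x)  ρ≗σ h       = subst (V M a) (ρ≗σ x) h
sat-cong M (natom a x) ρ≗σ h v     = h (subst (V M a) (sym (ρ≗σ x)) v)
sat-cong M (eq x y)    ρ≗σ h       = trans (sym (ρ≗σ x)) (trans h (ρ≗σ y))
sat-cong M (neq x y)   ρ≗σ h e     = h (trans (ρ≗σ x) (trans e (sym (ρ≗σ y))))
sat-cong M tt          ρ≗σ h       = h
sat-cong M ff          ρ≗σ h       = h
sat-cong M (φ ∧' ψ)    ρ≗σ (a , b) = sat-cong M φ ρ≗σ a , sat-cong M ψ ρ≗σ b
sat-cong M (φ ∨' ψ)    ρ≗σ h       = Sum.map (sat-cong M φ ρ≗σ) (sat-cong M ψ ρ≗σ) h
sat-cong M (∃' φ)      ρ≗σ (d , h) = d , sat-cong M φ (∷ₑ-cong d ρ≗σ) h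
sat-cong M (∀' φ)      ρ≗σ h d     = sat-cong M φ (∷ₑ-cong d ρ≗σ) (h d)
sat-cong M (∃∞' φ)     ρ≗σ h (l , complete) =
  h (l , λ d s → complete d (sat-cong M φ (∷ₑ-cong d ρ≗σ) s))
sat-cong M (∀∞' φ)     ρ≗σ (l , complete) =
  l , λ d ¬s → complete d (¬s ∘ sat-cong M φ (∷ₑ-cong d ρ≗σ))

sat-exs⁺ : ∀ {nA} (M : Model nA) k {φ : Fm nA k} (ρ : Fin k → D M) →
           sat M ρ φ → M ⊨ exs k φ
sat-exs⁺ M ℕ.zero    {φ} ρ h = sat-cong M φ (λ ()) h
sat-exs⁺ M (ℕ.suc k) {φ} ρ h =
  sat-exs⁺ M k (ρ ∘ suc) (ρ zero , sat-cong M φ (λ { zero → refl ; (suc i) → refl }) h)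

sat-exs⁻ : ∀ {nA} (M : Model nA) k {φ : Fm nA k} → M ⊨ exs k φ → ∃[ ρ ] sat M ρ φ
sat-exs⁻ M ℕ.zero    h = noVars , h
sat-exs⁻ M (ℕ.suc k) h with sat-exs⁻ M k h
... | ρ , (d , s) = d ∷ₑ ρ , s

module _ {nA m} (M : Model nA) (ρ : Fin m → D M) {X : Set} (g : X → Fm nA m) where

  sat-⋀⁺ : ∀ {l} → All (sat M ρ ∘ g) l → sat M ρ (⋀ (map g l))
  sat-⋀⁺ []       = tt
  sat-⋀⁺ (s ∷ ss) = s , sat-⋀⁺ ss

  sat-⋀⁻ : ∀ {l} → sat M ρ (⋀ (map g l)) → All (sat M ρ ∘ g) l
  sat-⋀⁻ {[]}    _        = []
  sat-⋀⁻ {_ ∷ _} (s , ss) = s ∷ sat-⋀⁻ ss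

  sat-⋁⁺ : ∀ {l} → Any (sat M ρ ∘ g) l → sat M ρ (⋁ (map g l))
  sat-⋁⁺ (here s)  = inj₁ s
  sat-⋁⁺ (there s) = inj₂ (sat-⋁⁺ s)

  sat-⋁⁻ : ∀ {l} → sat M ρ (⋁ (map g l)) → Any (sat M ρ ∘ g) l
  sat-⋁⁻ {_ ∷ _} (inj₁ s) = here s
  sat-⋁⁻ {_ ∷ _} (inj₂ s) = there (sat-⋁⁻ s)

⋁-map-⇔ : ∀ {nA} {B : Set} {R : B → Set} {M N : Model nA} {f g : B → Sentence nA}
          (bs : List B) → All R bs → (∀ {b} → R b → (M ⊨ f b) ⇔ (N ⊨ g b)) →
          (M ⊨ ⋁ (map f bs)) ⇔ (N ⊨ ⋁ (map g bs))
⋁-map-⇔ []       []         f⇔g = mk⇔ id id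
⋁-map-⇔ {M = M} {N} {f} {g} (b ∷ bs) (Rb ∷ Rbs) f⇔g =
  mk⇔ (Sum.map (to (f⇔g Rb)) (to rest)) (Sum.map (from (f⇔g Rb)) (from rest))
  where
    rest : (M ⊨ ⋁ (map f bs)) ⇔ (N ⊨ ⋁ (map g bs))
    rest = ⋁-map-⇔ bs Rbs f⇔g

module _ {X : Set} {R : X → X → Set} where

  AllPairs⇒All-pairs : ∀ {l} → AllPairs R l → All (uncurry R) (pairs l)
  AllPairs⇒All-pairs []        = []
  AllPairs⇒All-pairs (Rx ∷ Rl) = All.++⁺ (All.map⁺ Rx) (AllPairs⇒All-pairs Rl)

  All-pairs⇒AllPairs : ∀ {l} → All (uncurry R) (pairs l) → AllPairs R l
  All-pairs⇒AllPairs {[]}    _ = []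
  All-pairs⇒AllPairs {x ∷ l} h with All.++⁻ (map (x ,_) l) h
  ... | Rx , Rl = All.map⁻ Rx ∷ All-pairs⇒AllPairs Rl

module _ {nA m} (M : Model nA) {ρ : Fin m → D M} where

  sat-diff⁺ : ∀ {ys} → AllPairs (_≢_ on ρ) ys → sat M ρ (diff ys)
  sat-diff⁺ distinct = sat-⋀⁺ M ρ _ (AllPairs⇒All-pairs distinct)

  sat-diff⁻ : ∀ {ys} → sat M ρ (diff ys) → AllPairs (_≢_ on ρ) ys
  sat-diff⁻ h = All-pairs⇒AllPairs (sat-⋀⁻ M ρ _ h)

  sat-diff⇒⁻ : ∀ {ys} {ψ : Fm nA m} → AllPairs (_≢_ on ρ) ys →
               sat M ρ (diff⇒ ys ψ) → sat M ρ ψ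
  sat-diff⇒⁻ distinct (inj₁ coincide) =
    ⊥-elim (All.All¬⇒¬Any (AllPairs⇒All-pairs distinct) (sat-⋁⁻ M ρ _ coincide))
  sat-diff⇒⁻ distinct (inj₂ s)        = s

HasType : ∀ {nA} (M : Model nA) → PSet nA → D M → Set
HasType M S d = sat M (d ∷ₑ noVars) (τ S zero)

τ-cong : ∀ {nA m m'} (M N : Model nA) {ρ : Fin m → D M} {σ : Fin m' → D N}
         (S : PSet nA) {x y} → (∀ a → V M a (ρ x) ≡ V N a (σ y)) →
         sat M ρ (τ S x) ≡ sat N σ (τ S y)
τ-cong {nA} M N {ρ} {σ} S {x} {y} V≡ = literals (allFin nA)
  where
    literal : ∀ {k} → Fin k → Fin nA → Fm nA k
    literal z a = if lookup S a then atom a z else natom a z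

    literals : ∀ as → sat M ρ (⋀ (map (literal x) as)) ≡ sat N σ (⋀ (map (literal y) as))
    literals []       = refl
    literals (a ∷ as) with lookup S a
    ... | true  = cong₂ _×_ (V≡ a) (literals as)
    ... | false = cong₂ _×_ (cong ¬_ (V≡ a)) (literals as)

module _ {nA m} (M : Model nA) (ρ : Fin m → D M × ℕ) (S : PSet nA) (x : Fin m) where

  τ-π⁺ : HasType M S (proj₁ (ρ x)) → sat (πModel M) ρ (τ S x)
  τ-π⁺ = subst id (τ-cong M (πModel M) S (λ _ → refl))

  τ-π⁻ : sat (πModel M) ρ (τ S x) → HasType M S (proj₁ (ρ x))
  τ-π⁻ = subst id (τ-cong (πModel M) M S (λ _ → refl))

⋁τ : ∀ {nA m} → List (PSet nA) → Fm nA (ℕ.suc m)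
⋁τ Λ = ⋁ (map (λ S → τ S zero) Λ)

module _ {nA m} (M : Model nA) (z : D M × ℕ) (σ : Fin m → D M × ℕ) {Λ : List (PSet nA)}
  where

  ⋁τ-π⁺ : Any (λ S → HasType M S (proj₁ z)) Λ → sat (πModel M) (z ∷ₑ σ) (⋁τ Λ)
  ⋁τ-π⁺ = sat-⋁⁺ (πModel M) (z ∷ₑ σ) _ ∘
          Any.map λ {S} → τ-π⁺ M (z ∷ₑ σ) S zero

  ⋁τ-π⁻ : sat (πModel M) (z ∷ₑ σ) (⋁τ Λ) → Any (λ S → HasType M S (proj₁ z)) Λ
  ⋁τ-π⁻ = Any.map (λ {S} → τ-π⁻ M (z ∷ₑ σ) S zero) ∘
          sat-⋁⁻ (πModel M) (z ∷ₑ σ) _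

∃-∉ : (ns : List ℕ) → ∃[ n ] n ∉ ns
∃-∉ ns = ℕ.suc (max 0 ns) , λ n∈ns → n≮n (max 0 ns) (All.lookup (xs≤max 0 ns) n∈ns)

fibre-∉ : {X : Set} (d : X) (l : List (X × ℕ)) → ∃[ n ] (d , n) ∉ l
fibre-∉ d l with ∃-∉ (map proj₂ l)
... | n , n∉ = n , n∉ ∘ ∈-map⁺ proj₂

fibre⇒¬FiniteP : {X : Set} {P : X × ℕ → Set} (d : X) →
                 (∀ n → P (d , n)) → ¬ FiniteP P
fibre⇒¬FiniteP d P-fibre (l , complete) with fibre-∉ d l
... | n , ∉l = ∉l (complete (d , n) (P-fibre n))

-- FiniteP (¬_ ∘ P) only bounds the failures of P, so P at a fresh point needs excluded middle.
cofinite-meets-fibre : ExcludedMiddle 0ℓ → {X : Set} (P : X × ℕ → Set) →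
                       FiniteP (¬_ ∘ P) → ∀ d → ∃[ n ] P (d , n)
cofinite-meets-fibre em P (l , complete) d with fibre-∉ d l
... | n , ∉l with em {P (d , n)}
...   | yes p  = n , p
...   | no ¬p  = ⊥-elim (∉l (complete (d , n) ¬p))

record Realizes {nA} (M : Model nA) (T Λ : List (PSet nA)) : Set where
  field
    realized : ∀ {S} → S ∈ T → ∃ (HasType M S)
    covered  : ∀ d → Any (λ S → HasType M S d) Λ
open Realizes

circPart⇔Realizes : ∀ {nA} (M : Model nA) (T Λ : List (PSet nA)) →
                    (M ⊨ circPart T Λ) ⇔ Realizes M T Λ
circPart⇔Realizes M T Λ = mk⇔
  (λ (ex , cov) → record { realized = All.lookup (sat-⋀⁻ M noVars _ ex)
                          ; covered  = λ d → sat-⋁⁻ M (d ∷ₑ noVars) _ (cov d) })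
  (λ r → sat-⋀⁺ M noVars _ (All.tabulate (realized r))
       , λ d → sat-⋁⁺ M (d ∷ₑ noVars) _ (covered r d))

Realizes⇒∇-π : ∀ {nA} (M : Model nA) (T Λ : List (PSet nA)) →
               Realizes M T Λ → πModel M ⊨ ∇ T Λ
Realizes⇒∇-π M T Λ r = sat-exs⁺ (πModel M) (length T) witness (distinct , typed , rest)
  where
    xs : List (Fin (length T))
    xs = allFin (length T)

    witness : Fin (length T) → D M × ℕ
    witness i = proj₁ (realized r (∈-lookup i)) , toℕ i

    distinct : sat (πModel M) witness (diff xs)
    distinct = sat-diff⁺ (πModel M)
      (AllPairs.map (λ i≢j e → i≢j (toℕ-injective (cong proj₂ e))) (allFin⁺ (length T)))

    typed : sat (πModel M) witness (⋀ (map (λ i → τ (List.lookup T i) i) xs))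
    typed = sat-⋀⁺ (πModel M) witness (λ i → τ (List.lookup T i) i) {xs}
      (All.tabulate λ {i} _ →
        τ-π⁺ M witness (List.lookup T i) i (proj₂ (realized r (∈-lookup i))))

    rest : ∀ z → sat (πModel M) (z ∷ₑ witness) (diff⇒ (map suc xs ∷ʳ zero) (⋁τ Λ))
    rest z = inj₂ (⋁τ-π⁺ M z witness (covered r (proj₁ z)))

∇-π⇒Realizes : ∀ {nA} (M : Model nA) (T Λ : List (PSet nA)) →
               πModel M ⊨ ∇ T Λ → Realizes M T Λ
∇-π⇒Realizes M T Λ h with sat-exs⁻ (πModel M) (length T) h
... | ρ , (distinct , typed , rest) = record { realized = realized′ ; covered = covered′ }
  where
    xs : List (Fin (length T))
    xs = allFin (length T)

    typedAt : ∀ i → HasType M (List.lookup T i) (proj₁ (ρ i))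
    typedAt i = τ-π⁻ M ρ (List.lookup T i) i
      (All.lookup (sat-⋀⁻ (πModel M) ρ (λ i → τ (List.lookup T i) i) typed) (∈-allFin i))

    realized′ : ∀ {S} → S ∈ T → ∃ (HasType M S)
    realized′ S∈T = proj₁ (ρ i) ,
      subst (λ S → HasType M S (proj₁ (ρ i))) (sym (Any.lookup-index S∈T)) (typedAt i)
      where i = Any.index S∈T

    covered′ : ∀ d → Any (λ S → HasType M S d) Λ
    covered′ d with fibre-∉ d (map ρ xs)
    ... | n , ∉witnesses =
      ⋁τ-π⁻ M (d , n) ρ (sat-diff⇒⁻ (πModel M) {ψ = ⋁τ Λ} distinct′ (rest (d , n)))
      where
        fresh : ∀ i → ρ i ≢ (d , n)
        fresh i e = ∉witnesses (subst (_∈ map ρ xs) e (∈-map⁺ ρ (∈-allFin i)))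

        distinct′ : AllPairs (_≢_ on ((d , n) ∷ₑ ρ)) (map suc xs ∷ʳ zero)
        distinct′ = AllPairs.++⁺ (AllPairs.map⁺ (sat-diff⁻ (πModel M) distinct)) ([] ∷ [])
          (All.map⁺ (All.tabulate (λ {i} _ → fresh i ∷ [])))

Realizes⇒∇∞-π : ∀ {nA} (M : Model nA) {T Π Σ : List (PSet nA)} → Σ ⊆ T →
                Realizes M T Σ → πModel M ⊨ ∇∞ T Π Σ
Realizes⇒∇∞-π M {T} {Π} {Σ} Σ⊆T r = ∇Π++Σ , infinitelyOften , ([] , noneUncovered)
  where
    ∇Π++Σ : πModel M ⊨ ∇ T (Π ++ Σ)
    ∇Π++Σ = Realizes⇒∇-π M T (Π ++ Σ)
      (record { realized = realized r ; covered = Any.++⁺ʳ Π ∘ covered r })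

    infinitelyOften : πModel M ⊨ ⋀ (map (λ S → ∃∞' (τ S zero)) Σ)
    infinitelyOften = sat-⋀⁺ (πModel M) noVars (λ S → ∃∞' (τ S zero)) {Σ}
      (All.tabulate λ {S} S∈Σ → let (d , t) = realized r (Σ⊆T S∈Σ)
      in fibre⇒¬FiniteP d (λ n → τ-π⁺ M ((d , n) ∷ₑ noVars) S zero t))

    noneUncovered : ∀ z → ¬ sat (πModel M) (z ∷ₑ noVars) (⋁τ Σ) → z ∈ []
    noneUncovered z uncovered = ⊥-elim (uncovered (⋁τ-π⁺ M z noVars (covered r (proj₁ z))))

∇∞-π⇒Realizes : ∀ {nA} → ExcludedMiddle 0ℓ → (M : Model nA)
                {T Π Σ : List (PSet nA)} →
                πModel M ⊨ ∇∞ T Π Σ → Realizes M T Σ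
∇∞-π⇒Realizes em M {T} {Π} {Σ} (∇Π++Σ , _ , cofinite) = record
  { realized = realized (∇-π⇒Realizes M T (Π ++ Σ) ∇Π++Σ)
  ; covered  = λ d → let (n , c) = cofinite-meets-fibre em covered-π cofinite d
                     in ⋁τ-π⁻ M (d , n) noVars c
  }
  where
    covered-π : D M × ℕ → Set
    covered-π z = sat (πModel M) (z ∷ₑ noVars) (⋁τ Σ)

circPart⇔∇-π : ∀ {nA} (M : Model nA) (T Λ : List (PSet nA)) →
               (M ⊨ circPart T Λ) ⇔ (πModel M ⊨ ∇ T Λ)
circPart⇔∇-π M T Λ =
  mk⇔ (Realizes⇒∇-π M T Λ) (∇-π⇒Realizes M T Λ) ⇔-∘ circPart⇔Realizes M T Λ

circPart⇔∇∞-π : ∀ {nA} → ExcludedMiddle 0ℓ → (M : Model nA) {T Π Σ : List (PSet nA)} →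
                Σ ⊆ T → (M ⊨ circPart T Σ) ⇔ (πModel M ⊨ ∇∞ T Π Σ)
circPart⇔∇∞-π em M {T} {Σ = Σ} Σ⊆T =
  mk⇔ (Realizes⇒∇∞-π M Σ⊆T) (∇∞-π⇒Realizes em M) ⇔-∘ circPart⇔Realizes M T Σ

proposition6p12 :
    ExcludedMiddle 0ℓ →
    (∀ (nA : ℕ) (bs : List (Basic nA)) → All WellFormed bs →
       ∀ (M : Model nA) → (M ⊨ circ bs) ⇔ (πModel M ⊨ basicSentence bs))
    ×
    (∀ (nA : ℕ) (bs : List (Basic∞ nA)) → All WellFormed∞ bs →
       ∀ (M : Model nA) → (M ⊨ bullet bs) ⇔ (πModel M ⊨ basicSentence∞ bs))
proposition6p12 em =
  (λ nA bs wf M → ⋁-map-⇔ bs wf λ {b} _ → circPart⇔∇-π M (T b) (Π b)) ,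
  (λ nA bs wf M → ⋁-map-⇔ bs wf λ { {basic∞ T Π Σ} (Σ⊆Π , Π⊆T) →
    circPart⇔∇∞-π em M (Π⊆T ∘ Σ⊆Π) })
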